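{- Let $G$ be a trigraph with underlying simple graph $H$. If $\operatorname{stww}(G)>\Delta(G)^2$, then $\operatorname{tww}(G)=\operatorname{tww}(H)$.
   Context: A trigraph is a finite simple graph whose edges are colored red or black; its underlying simple graph forgets the colors (and is regarded as a trigraph with all edges black). $\Delta(G)$ is the maximum degree of the underlying graph. For a partition $\mathcal{P}$ of $V(G)$, the quotient trigraph $G/\mathcal{P}$ has vertex set $\mathcal{P}$; two parts $U,W$ are joined by a black edge if every pair $u\in U,w\in W$ is a black edge, are non-adjacent if no such pair is an edge, and are joined by a red edge otherwise. A contraction sequence of an $n$-vertex trigraph $G$ is a sequence $\mathcal{P}_n,\dots,\mathcal{P}_1$ of partitions with $\mathcal{P}_n$ discrete and each $\mathcal{P}_i$ obtained from $\mathcal{P}_{i+1}$ by merging two parts; its width is the maximum red degree over all $G/\mathcal{P}_i$; $\operatorname{tww}(G)$ is the minimum width. $\operatorname{stww}(G)\coloneqq\operatorname{tww}(G_{\mathrm{red}})$, where $G_{\mathrm{red}}$ is obtained from $G$ by coloring all edges red. -}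

module Defs where

open import Data.Nat using (ℕ; zero; suc; _≤_; _⊔_)
open import Data.Bool using (Bool; true; false; if_then_else_; _∧_; not)
open import Data.Fin using (Fin; _≟_)
open import Data.List using (List; []; _∷_; length; map; foldr; filterᵇ; concatMap; allFin)
open import Data.Product using (Σ; _×_; _,_)
open import Function using (_∘_)
open import Function.Definitions using (Injective; Surjective)
open import Relation.Nullary using (does)
open import Relation.Binary.PropositionalEquality using (_≡_; cong)

data Colour : Set where
  none black red : Colour

isBlack isNone isRed : Colour → Bool
isBlack black = true
isBlack _     = false
isNone none = true
isNone _    = false
isRed red = true
isRed _   = false

-- A trigraph on the vertex set Fin n: a finite simple graph whose
-- edges are coloured black or red (col u v ≡ none means non-adjacent).

record Trigraph (n : ℕ) : Set where
  field
    col    : Fin n → Fin n → Colour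
    sym    : ∀ u v → col u v ≡ col v u
    irrefl : ∀ v → col v v ≡ none
open Trigraph public

blacken redden : Colour → Colour
blacken none = none
blacken _    = black
redden none = none
redden _    = red

underlying : ∀ {n} → Trigraph n → Trigraph n
underlying G = record
  { col    = λ u v → blacken (col G u v)
  ; sym    = λ u v → cong blacken (sym G u v)
  ; irrefl = λ v → cong blacken (irrefl G v) }

allRed : ∀ {n} → Trigraph n → Trigraph n
allRed G = record
  { col    = λ u v → redden (col G u v)
  ; sym    = λ u v → cong redden (sym G u v)
  ; irrefl = λ v → cong redden (irrefl G v) }

countᵇ : ∀ {k} → (Fin k → Bool) → ℕ
countᵇ {k} p = length (filterᵇ p (allFin k))

maxOver : ∀ {k} → (Fin k → ℕ) → ℕ
maxOver {k} f = foldr _⊔_ 0 (map f (allFin k))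

allᵇ : {A : Set} → (A → Bool) → List A → Bool
allᵇ p = foldr (λ x b → p x ∧ b) true

_==_ : ∀ {k} → Fin k → Fin k → Bool
a == b = does (a ≟ b)

degree : ∀ {n} → Trigraph n → Fin n → ℕ
degree G v = countᵇ (λ w → not (isNone (col G v w)))

Δ : ∀ {n} → Trigraph n → ℕ
Δ G = maxOver (degree G)

-- Partitions of V(G) = Fin n are represented by a surjective labelling
-- f : Fin n → Fin k; the parts are the (non-empty) fibres of f.
-- Quotient trigraph colour between parts a and b.

pairColours : ∀ {n k} → Trigraph n → (Fin n → Fin k) → Fin k → Fin k → List Colour
pairColours {n} G f a b =
  concatMap (λ u → concatMap (λ w →
      if (f u == a) ∧ (f w == b) then col G u w ∷ [] else [])
    (allFin n)) (allFin n)

quotCol : ∀ {n k} → Trigraph n → (Fin n → Fin k) → Fin k → Fin k → Colour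
quotCol G f a b =
  if allᵇ isBlack (pairColours G f a b) then black
  else if allᵇ isNone (pairColours G f a b) then none
  else red

redDeg : ∀ {n k} → Trigraph n → (Fin n → Fin k) → Fin k → ℕ
redDeg G f a = countᵇ (λ b → not (a == b) ∧ isRed (quotCol G f a b))

RedDeg≤ : ∀ {n k} → Trigraph n → ℕ → (Fin n → Fin k) → Set
RedDeg≤ G d f = ∀ a → redDeg G f a ≤ d

-- A step passes
-- from a partition with suc k parts to one with k parts via a
-- surjection g, i.e. exactly two parts are merged.

data SeqFrom {n : ℕ} (G : Trigraph n) (d : ℕ) : {k : ℕ} → (Fin n → Fin k) → Set where
  last : ∀ {k} (f : Fin n → Fin k) → k ≤ 1 → RedDeg≤ G d f → SeqFrom G d f
  step : ∀ {k} (f : Fin n → Fin (suc k)) (g : Fin (suc k) → Fin k) →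
         Surjective _≡_ _≡_ g → RedDeg≤ G d f → SeqFrom G d (g ∘ f) →
         SeqFrom G d f

-- G has a contraction sequence of width at most d
-- (the first partition is discrete: an injective labelling Fin n → Fin n)
HasWidth≤ : ∀ {n} → Trigraph n → ℕ → Set
HasWidth≤ {n} G d =
  Σ (Fin n → Fin n) λ f → Injective _≡_ _≡_ f × SeqFrom G d f

IsTww : ∀ {n} → Trigraph n → ℕ → Set
IsTww G t = HasWidth≤ G t × (∀ d → HasWidth≤ G d → t ≤ d)

IsStww : ∀ {n} → Trigraph n → ℕ → Set
IsStww G s = IsTww (allRed G) s

{-# OPTIONS --safe #-}
-- Every red pair of parts of H/P is red in G/P, and every red pair of G/P is red in G_red/P,
-- so tww(H) ≤ tww(G) ≤ stww(G).  Conversely, let part A be red to B in G_red/P.  Unless A is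
-- red to B in H/P as well, A and B are completely joined in H; then any vertex of B is adjacent
-- to all of A, so |A| ≤ Δ, and since every red neighbour of A in G_red/P contains a neighbour of
-- a vertex of A, A has red degree at most |A|·Δ ≤ Δ².  Hence stww(G) ≤ max(tww(H), Δ²), and
-- stww(G) > Δ² forces stww(G) ≤ tww(H).
module Submission where

open import Defs
open import Data.Nat using (ℕ; _<_; _*_)
open import Relation.Binary.PropositionalEquality using (_≡_)

open import Data.Bool using (Bool; true; false; if_then_else_; _∧_; not)
import Data.Bool as Bool
open import Data.Bool.Properties using (¬-not)
open import Data.Fin using (Fin; zero; suc; _≟_)
open import Data.Fin.Properties using (any?)
open import Data.List using (List; []; _∷_; length; concatMap; foldr; filterᵇ; tabulate; allFin)
open import Data.List.Membership.Propositional using (_∈_; lose)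
open import Data.List.Membership.Propositional.Properties using (∈-allFin; ∈-map⁺)
open import Data.List.Relation.Unary.Any using (Any; here; there; satisfied)
open import Data.List.Relation.Unary.Any.Properties using (concatMap⁺; concatMap⁻)
open import Data.Nat using (zero; suc; _≤_; _⊔_; _+_; z≤n)
open import Data.Nat.Properties
  using (≤-refl; ≤-trans; ≤-antisym; +-mono-≤; *-monoˡ-≤; *-monoʳ-≤;
         *-identityˡ; *-identityʳ; m≤m+n; m≤n+m; m≤m⊔n; m≤n⊔m; ⊔-sel; ⊔-monoˡ-≤; <⇒≱;
         +-*-semiring; module ≤-Reasoning)
open import Algebra.Properties.Semiring.Sum +-*-semiring
  using (sum; ∑-distrib-+; sum-cong-≗; *-distribʳ-sum)
open import Data.Product using (∃; _×_; _,_; proj₁; proj₂)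
open import Data.Sum using (inj₁; inj₂)
open import Function using (_∘_; id)
open import Relation.Binary.PropositionalEquality using (refl; trans; cong; cong₂; subst; subst₂) renaming (sym to ≡-sym)
open import Relation.Nullary using (Dec; does; proof; yes; no; contradiction; _×-dec_)
open import Relation.Nullary.Reflects using (Reflects; invert)
open import Relation.Nullary.Decidable using (dec-true)

does-true⁻ : ∀ {a} {A : Set a} (d : Dec A) → does d ≡ true → A
does-true⁻ d e = invert (subst (Reflects _) e (proof d))

==⇒≡ : ∀ {k} {x y : Fin k} → (x == y) ≡ true → x ≡ y
==⇒≡ = does-true⁻ (_ ≟ _)

≡⇒== : ∀ {k} {x y : Fin k} → x ≡ y → (x == y) ≡ true
≡⇒== = dec-true (_ ≟ _)

∧-true⁻ : ∀ {x y} → x ∧ y ≡ true → x ≡ true × y ≡ true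
∧-true⁻ {true} {true} refl = refl , refl

nor-true⁻ : ∀ {x y} → not x ∧ not y ≡ true → x ≡ false × y ≡ false
nor-true⁻ {false} {false} refl = refl , refl

any : ∀ {k} → (Fin k → Bool) → Bool
any p = does (any? λ i → p i Bool.≟ true)

any⁺ : ∀ {k} {p : Fin k → Bool} i → p i ≡ true → any p ≡ true
any⁺ i pᵢ = dec-true (any? _) (i , pᵢ)

any⁻ : ∀ {k} {p : Fin k → Bool} → any p ≡ true → ∃ λ i → p i ≡ true
any⁻ = does-true⁻ (any? _)

∈-if : ∀ {A : Set} {c} {x : A} → c ≡ true → x ∈ (if c then x ∷ [] else [])
∈-if refl = here refl

Any-if⁻ : ∀ {A : Set} {P : A → Set} {c x} → Any P (if c then x ∷ [] else []) → c ≡ true × P x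
Any-if⁻ {c = true} (here px) = refl , px

allᵇ-true⁻ : ∀ {A : Set} {p : A → Bool} {x xs} → allᵇ p xs ≡ true → x ∈ xs → p x ≡ true
allᵇ-true⁻ all (here refl)  = proj₁ (∧-true⁻ all)
allᵇ-true⁻ all (there x∈xs) = allᵇ-true⁻ (proj₂ (∧-true⁻ all)) x∈xs

allᵇ-false⁻ : ∀ {A : Set} {p : A → Bool} {xs} → allᵇ p xs ≡ false → Any (λ x → p x ≡ false) xs
allᵇ-false⁻ {p = p} {x ∷ xs} all with p x in pₓ
... | true  = there (allᵇ-false⁻ all)
... | false = here pₓ

≤-maxOver : ∀ {k} (f : Fin k → ℕ) i → f i ≤ maxOver f
≤-maxOver f i = ≤-foldr-⊔ (∈-map⁺ f (∈-allFin i))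
  where
  ≤-foldr-⊔ : ∀ {x} {xs : List ℕ} → x ∈ xs → x ≤ foldr _⊔_ 0 xs
  ≤-foldr-⊔              (here refl)  = m≤m⊔n _ _
  ≤-foldr-⊔ {xs = y ∷ _} (there x∈xs) = ≤-trans (≤-foldr-⊔ x∈xs) (m≤n⊔m y _)

χ : Bool → ℕ
χ true  = 1
χ false = 0

-- countᵇ by recursion on k, so that it can be reasoned about by induction over Fin k.
count : ∀ {k} → (Fin k → Bool) → ℕ
count {zero}  p = 0
count {suc k} p = χ (p zero) + count (p ∘ suc)

count-false : ∀ k → count {k} (λ _ → false) ≡ 0
count-false zero    = refl
count-false (suc k) = count-false k

count≡∑χ : ∀ {k} (p : Fin k → Bool) → count p ≡ sum (χ ∘ p)
count≡∑χ {zero}  p = refl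
count≡∑χ {suc k} p = cong (χ (p zero) +_) (count≡∑χ (p ∘ suc))

countᵇ≡count : ∀ {k} (p : Fin k → Bool) → countᵇ p ≡ count p
countᵇ≡count {k} p = length-filter-tabulate k id
  where
  length-filter-tabulate : ∀ {A : Set} k (g : Fin k → A) {p : A → Bool} →
    length (filterᵇ p (tabulate g)) ≡ count (p ∘ g)
  length-filter-tabulate zero    g = refl
  length-filter-tabulate (suc k) g {p} with p (g zero)
  ... | true  = cong suc (length-filter-tabulate k (g ∘ suc))
  ... | false = length-filter-tabulate k (g ∘ suc)

χ-mono : ∀ {x y} → (x ≡ true → y ≡ true) → χ x ≤ χ y
χ-mono {false} _ = z≤n
χ-mono {true}  h rewrite h refl = ≤-refl

count-mono : ∀ {k} {p q : Fin k → Bool} → (∀ i → p i ≡ true → q i ≡ true) → count p ≤ count q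
count-mono {zero}  p⊆q = z≤n
count-mono {suc k} p⊆q = +-mono-≤ (χ-mono (p⊆q zero)) (count-mono (p⊆q ∘ suc))

χ≤count : ∀ {k} (p : Fin k → Bool) i → χ (p i) ≤ count p
χ≤count p zero    = m≤m+n (χ (p zero)) _
χ≤count p (suc i) = ≤-trans (χ≤count (p ∘ suc) i) (m≤n+m _ (χ (p zero)))

χ≤count-∃ : ∀ {k x} {p : Fin k → Bool} → (x ≡ true → ∃ λ i → p i ≡ true) → χ x ≤ count p
χ≤count-∃ {x = false} _ = z≤n
χ≤count-∃ {x = true} {p} h with h refl
... | i , pᵢ = subst (λ y → χ y ≤ count p) pᵢ (χ≤count p i)

sum-mono : ∀ {k} {f g : Fin k → ℕ} → (∀ i → f i ≤ g i) → sum f ≤ sum g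
sum-mono {zero}  _   = z≤n
sum-mono {suc k} f≤g = +-mono-≤ (f≤g zero) (sum-mono (f≤g ∘ suc))

count-∧ˡ : ∀ {k} c (p : Fin k → Bool) → count (λ i → c ∧ p i) ≡ χ c * count p
count-∧ˡ     true  p = ≡-sym (*-identityˡ (count p))
count-∧ˡ {k} false p = count-false k

count-== : ∀ {k} (x : Fin k) → count (x ==_) ≡ 1
count-== {suc k} zero    = cong suc (count-false k)
count-==         (suc x) = count-== x

count-cover : ∀ {m k} (R : Fin k → Bool) (P : Fin m → Fin k → Bool) →
  (∀ b → R b ≡ true → ∃ λ u → P u b ≡ true) → count R ≤ sum (λ u → count (P u))
count-cover {k = zero}  R P cover = z≤n
count-cover {k = suc k} R P cover = begin
  χ (R zero) + count (R ∘ suc)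
    ≤⟨ +-mono-≤ (χ≤count-∃ (cover zero)) (count-cover (R ∘ suc) (λ u → P u ∘ suc) (cover ∘ suc)) ⟩
  count (λ u → P u zero) + sum (λ u → count (P u ∘ suc))
    ≡⟨ cong (_+ sum (λ u → count (P u ∘ suc))) (count≡∑χ (λ u → P u zero)) ⟩
  sum (λ u → χ (P u zero)) + sum (λ u → count (P u ∘ suc))
    ≡⟨ ≡-sym (∑-distrib-+ (λ u → χ (P u zero)) (λ u → count (P u ∘ suc))) ⟩
  sum (λ u → count (P u))
    ∎
  where open ≤-Reasoning

count-image : ∀ {m k} (q : Fin m → Bool) (h : Fin m → Fin k) →
  count (λ b → any (λ w → q w ∧ (h w == b))) ≤ count q
count-image q h = begin
  count (λ b → any (λ w → q w ∧ (h w == b)))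
    ≤⟨ count-cover _ (λ w b → q w ∧ (h w == b)) (λ b → any⁻) ⟩
  sum (λ w → count (λ b → q w ∧ (h w == b)))
    ≡⟨ sum-cong-≗ (λ w → count-∧ˡ (q w) (h w ==_)) ⟩
  sum (λ w → χ (q w) * count (h w ==_))
    ≡⟨ sum-cong-≗ (λ w → trans (cong (χ (q w) *_) (count-== (h w))) (*-identityʳ (χ (q w)))) ⟩
  sum (χ ∘ q)
    ≡⟨ ≡-sym (count≡∑χ q) ⟩
  count q
    ∎
  where open ≤-Reasoning

Edge NonBlack : Colour → Set
Edge     c = isNone c ≡ false
NonBlack c = isBlack c ≡ false

isNone-redden : ∀ c → isNone (redden c) ≡ isNone c
isNone-redden none  = refl
isNone-redden black = refl
isNone-redden red   = refl

isNone-blacken : ∀ c → isNone (blacken c) ≡ isNone c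
isNone-blacken none  = refl
isNone-blacken black = refl
isNone-blacken red   = refl

isBlack-redden : ∀ c → isBlack (redden c) ≡ false
isBlack-redden none  = refl
isBlack-redden black = refl
isBlack-redden red   = refl

isBlack-blacken : ∀ c → isBlack (blacken c) ≡ not (isNone c)
isBlack-blacken none  = refl
isBlack-blacken black = refl
isBlack-blacken red   = refl

blacken-nonBlack⁻ : ∀ {c} → NonBlack (blacken c) → NonBlack c
blacken-nonBlack⁻ {none} _ = refl

module _ {n k : ℕ} where

  record Crossing (G : Trigraph n) (f : Fin n → Fin k) (a b : Fin k) (P : Colour → Set) : Set where
    constructor crossing
    field
      u w : Fin n
      u∈a : f u ≡ a
      w∈b : f w ≡ b
      colour : P (col G u w)

  Crossing-map : ∀ {G G′ : Trigraph n} {f a b} {P Q : Colour → Set} →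
    (∀ {u w} → P (col G u w) → Q (col G′ u w)) → Crossing G f a b P → Crossing G′ f a b Q
  Crossing-map h (crossing u w fu fw p) = crossing u w fu fw (h p)

  module _ (G : Trigraph n) (f : Fin n → Fin k) (a b : Fin k) where

    private
      cell : Fin n → Fin n → List Colour
      cell u w = if (f u == a) ∧ (f w == b) then col G u w ∷ [] else []

      row : Fin n → List Colour
      row u = concatMap (cell u) (allFin n)

    ∈-pairColours : ∀ {u w} → f u ≡ a → f w ≡ b → col G u w ∈ pairColours G f a b
    ∈-pairColours {u} {w} fu fw =
      concatMap⁺ row (lose (∈-allFin u)
        (concatMap⁺ (cell u) (lose (∈-allFin w) (∈-if (cong₂ _∧_ (≡⇒== fu) (≡⇒== fw))))))

    Any-pairColours⁻ : ∀ {P : Colour → Set} → Any P (pairColours G f a b) → Crossing G f a b P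
    Any-pairColours⁻ any-uw with satisfied (concatMap⁻ row {xs = allFin n} any-uw)
    ... | u , any-w with satisfied (concatMap⁻ (cell u) {xs = allFin n} any-w)
    ... | w , any-if with Any-if⁻ any-if
    ... | inside , p = crossing u w (==⇒≡ (proj₁ (∧-true⁻ inside))) (==⇒≡ (proj₂ (∧-true⁻ inside))) p

    allPairs-true⁻ : ∀ {p u w} → allᵇ p (pairColours G f a b) ≡ true →
      f u ≡ a → f w ≡ b → p (col G u w) ≡ true
    allPairs-true⁻ all fu fw = allᵇ-true⁻ all (∈-pairColours fu fw)

    allPairs-false⁻ : ∀ {p} → allᵇ p (pairColours G f a b) ≡ false →
      Crossing G f a b (λ c → p c ≡ false)
    allPairs-false⁻ = Any-pairColours⁻ ∘ allᵇ-false⁻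

    allPairs-false⁺ : ∀ {p} → Crossing G f a b (λ c → p c ≡ false) →
      allᵇ p (pairColours G f a b) ≡ false
    allPairs-false⁺ (crossing u w fu fw pᵤᵥ) =
      ¬-not λ all → contradiction (trans (≡-sym (allPairs-true⁻ all fu fw)) pᵤᵥ) λ ()

    isRed-quotCol : isRed (quotCol G f a b) ≡
      not (allᵇ isBlack (pairColours G f a b)) ∧ not (allᵇ isNone (pairColours G f a b))
    isRed-quotCol with allᵇ isBlack (pairColours G f a b) | allᵇ isNone (pairColours G f a b)
    ... | true  | _     = refl
    ... | false | true  = refl
    ... | false | false = refl

    isRed-quotCol⁻ : isRed (quotCol G f a b) ≡ true →
      Crossing G f a b NonBlack × Crossing G f a b Edge
    isRed-quotCol⁻ redᵃᵇ with nor-true⁻ (trans (≡-sym isRed-quotCol) redᵃᵇ)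
    ... | notAllBlack , notAllNone = allPairs-false⁻ notAllBlack , allPairs-false⁻ notAllNone

    isRed-quotCol⁺ : Crossing G f a b NonBlack → Crossing G f a b Edge →
      isRed (quotCol G f a b) ≡ true
    isRed-quotCol⁺ nonBlack edge =
      trans isRed-quotCol (cong₂ (λ x y → not x ∧ not y) (allPairs-false⁺ nonBlack) (allPairs-false⁺ edge))

    notRed-black : Crossing G f a b Edge → isRed (quotCol G f a b) ≡ false →
      ∀ {u w} → f u ≡ a → f w ≡ b → isBlack (col G u w) ≡ true
    notRed-black edge notRed = allPairs-true⁻ (¬-not λ notAllBlack →
      contradiction (trans (≡-sym (isRed-quotCol⁺ (allPairs-false⁻ notAllBlack) edge)) notRed) λ ())

edge : ∀ {n} → Trigraph n → Fin n → Fin n → Bool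
edge G u w = not (isNone (col G u w))

count-edge≤Δ : ∀ {n} (G : Trigraph n) u → count (edge G u) ≤ Δ G
count-edge≤Δ G u = subst (_≤ Δ G) (countᵇ≡count (edge G u)) (≤-maxOver (degree G) u)

redAdjacent : ∀ {n k} → Trigraph n → (Fin n → Fin k) → Fin k → Fin k → Bool
redAdjacent G f a b = not (a == b) ∧ isRed (quotCol G f a b)

redDeg≡count : ∀ {n k} (G : Trigraph n) (f : Fin n → Fin k) a → redDeg G f a ≡ count (redAdjacent G f a)
redDeg≡count G f a = countᵇ≡count (redAdjacent G f a)

redDeg-mono : ∀ {n k} (G₁ G₂ : Trigraph n) (f : Fin n → Fin k) a →
  (∀ b → isRed (quotCol G₁ f a b) ≡ true → isRed (quotCol G₂ f a b) ≡ true) →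
  redDeg G₁ f a ≤ redDeg G₂ f a
redDeg-mono G₁ G₂ f a red⇒red =
  subst₂ _≤_ (≡-sym (redDeg≡count G₁ f a)) (≡-sym (redDeg≡count G₂ f a))
    (count-mono λ b e → let a≢b , redᵃᵇ = ∧-true⁻ e in cong₂ _∧_ a≢b (red⇒red b redᵃᵇ))

module _ {n k} (G : Trigraph n) (f : Fin n → Fin k) (a : Fin k) where

  redDeg≤redDeg-allRed : redDeg G f a ≤ redDeg (allRed G) f a
  redDeg≤redDeg-allRed = redDeg-mono G (allRed G) f a λ b redᵃᵇ →
    let edges = proj₂ (isRed-quotCol⁻ G f a b redᵃᵇ) in
    isRed-quotCol⁺ (allRed G) f a b
      (Crossing-map (λ {u} {w} _ → isBlack-redden (col G u w)) edges)
      (Crossing-map (λ {u} {w} → trans (isNone-redden (col G u w))) edges)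

  redDeg-underlying≤redDeg : redDeg (underlying G) f a ≤ redDeg G f a
  redDeg-underlying≤redDeg = redDeg-mono (underlying G) G f a λ b redᵃᵇ →
    let nonBlacks , edges = isRed-quotCol⁻ (underlying G) f a b redᵃᵇ in
    isRed-quotCol⁺ G f a b
      (Crossing-map blacken-nonBlack⁻ nonBlacks)
      (Crossing-map (λ {u} {w} → trans (≡-sym (isNone-blacken (col G u w)))) edges)

  redDeg-allRed≤partSize*Δ : redDeg (allRed G) f a ≤ count (λ u → f u == a) * Δ G
  redDeg-allRed≤partSize*Δ = begin
    redDeg (allRed G) f a
      ≡⟨ redDeg≡count (allRed G) f a ⟩
    count (redAdjacent (allRed G) f a)
      ≤⟨ count-cover _ (λ u b → (f u == a) ∧ reaches u b) cover ⟩
    sum (λ u → count (λ b → (f u == a) ∧ reaches u b))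
      ≡⟨ sum-cong-≗ (λ u → count-∧ˡ (f u == a) (reaches u)) ⟩
    sum (λ u → χ (f u == a) * count (reaches u))
      ≤⟨ sum-mono (λ u → *-monoʳ-≤ (χ (f u == a)) (count-reaches≤Δ u)) ⟩
    sum (λ u → χ (f u == a) * Δ G)
      ≡⟨ ≡-sym (*-distribʳ-sum (Δ G) (λ u → χ (f u == a))) ⟩
    sum (λ u → χ (f u == a)) * Δ G
      ≡⟨ cong (_* Δ G) (≡-sym (count≡∑χ (λ u → f u == a))) ⟩
    count (λ u → f u == a) * Δ G
      ∎
    where
    open ≤-Reasoning
    reaches : Fin n → Fin k → Bool
    reaches u b = any (λ w → edge G u w ∧ (f w == b))
    count-reaches≤Δ : ∀ u → count (reaches u) ≤ Δ G
    count-reaches≤Δ u = ≤-trans (count-image (edge G u) f) (count-edge≤Δ G u)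
    cover : ∀ b → redAdjacent (allRed G) f a b ≡ true →
      ∃ λ u → (f u == a) ∧ reaches u b ≡ true
    cover b e with isRed-quotCol⁻ (allRed G) f a b (proj₂ (∧-true⁻ e))
    ... | _ , crossing u w fu fw edgeᵤᵥ = u , cong₂ _∧_ (≡⇒== fu)
      (any⁺ w (cong₂ _∧_ (cong not (trans (≡-sym (isNone-redden (col G u w))) edgeᵤᵥ)) (≡⇒== fw)))

  partSize≤Δ : ∀ {w} → (∀ {u} → f u ≡ a → edge G w u ≡ true) → count (λ u → f u == a) ≤ Δ G
  partSize≤Δ {w} adjacent = ≤-trans (count-mono λ u e → adjacent {u} (==⇒≡ e)) (count-edge≤Δ G w)

  redDeg-allRed≤redDeg-underlying⊔Δ² : redDeg (allRed G) f a ≤ redDeg (underlying G) f a ⊔ Δ G * Δ G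
  redDeg-allRed≤redDeg-underlying⊔Δ²
    with any? (λ b → isRed (quotCol (allRed G) f a b) Bool.≟ true
                      ×-dec isRed (quotCol (underlying G) f a b) Bool.≟ false)
  ... | no noSuchPart = ≤-trans
    (redDeg-mono (allRed G) (underlying G) f a λ b redᵃᵇ → ¬-not λ notRed → noSuchPart (b , redᵃᵇ , notRed))
    (m≤m⊔n _ _)
  ... | yes (b , redᴳ , notRedᴴ) with isRed-quotCol⁻ (allRed G) f a b redᴳ
  ... | _ , edges@(crossing _ w _ fw _) =
    ≤-trans (≤-trans redDeg-allRed≤partSize*Δ (*-monoˡ-≤ (Δ G) (partSize≤Δ adjacent))) (m≤n⊔m _ _)
    where
    edgesᴴ : Crossing (underlying G) f a b Edge
    edgesᴴ = Crossing-map (λ {u} {w} e →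
      trans (isNone-blacken (col G u w)) (trans (≡-sym (isNone-redden (col G u w))) e)) edges
    adjacent : ∀ {u} → f u ≡ a → edge G w u ≡ true
    adjacent {u} fu = trans (cong (not ∘ isNone) (sym G w u))
      (trans (≡-sym (isBlack-blacken (col G u w))) (notRed-black (underlying G) f a b edgesᴴ notRedᴴ fu fw))

module _ {n} {G₁ G₂ : Trigraph n} {d₁ d₂ : ℕ}
         (transfer : ∀ {k} (f : Fin n → Fin k) → RedDeg≤ G₁ d₁ f → RedDeg≤ G₂ d₂ f) where

  SeqFrom-map : ∀ {k} {f : Fin n → Fin k} → SeqFrom G₁ d₁ f → SeqFrom G₂ d₂ f
  SeqFrom-map (last f k≤1 red≤)        = last f k≤1 (transfer f red≤)
  SeqFrom-map (step f g surj red≤ seq) = step f g surj (transfer f red≤) (SeqFrom-map seq)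

  HasWidth≤-map : HasWidth≤ G₁ d₁ → HasWidth≤ G₂ d₂
  HasWidth≤-map (f , injective , seq) = f , injective , SeqFrom-map seq

module _ {n} (G : Trigraph n) where

  tww-underlying≤tww : ∀ {t t′} → IsTww G t → IsTww (underlying G) t′ → t′ ≤ t
  tww-underlying≤tww (width≤t , _) (_ , t′-minimal) = t′-minimal _
    (HasWidth≤-map (λ f red≤ a → ≤-trans (redDeg-underlying≤redDeg G f a) (red≤ a)) width≤t)

  tww≤stww : ∀ {t s} → IsTww G t → IsStww G s → t ≤ s
  tww≤stww (_ , t-minimal) (width≤s , _) = t-minimal _
    (HasWidth≤-map (λ f red≤ a → ≤-trans (redDeg≤redDeg-allRed G f a) (red≤ a)) width≤s)

  stww≤tww-underlying⊔Δ² : ∀ {s t′} → IsStww G s → IsTww (underlying G) t′ → s ≤ t′ ⊔ Δ G * Δ G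
  stww≤tww-underlying⊔Δ² (_ , s-minimal) (width≤t′ , _) = s-minimal _
    (HasWidth≤-map (λ f red≤ a → ≤-trans (redDeg-allRed≤redDeg-underlying⊔Δ² G f a)
                                          (⊔-monoˡ-≤ (Δ G * Δ G) (red≤ a))) width≤t′)

≤⊔-<⇒≤ : ∀ {m n o} → m ≤ n ⊔ o → o < m → m ≤ n
≤⊔-<⇒≤ {m} {n} {o} m≤n⊔o o<m with ⊔-sel n o
... | inj₁ n⊔o≡n = subst (m ≤_) n⊔o≡n m≤n⊔o
... | inj₂ n⊔o≡o = contradiction (subst (m ≤_) n⊔o≡o m≤n⊔o) (<⇒≱ o<m)

corollary3p2 : ∀ {n} (G : Trigraph n) (s t t′ : ℕ) →
    IsStww G s → Δ G * Δ G < s →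
    IsTww G t → IsTww (underlying G) t′ → t ≡ t′
corollary3p2 G s t t′ stww Δ²<s tww tww′ =
  ≤-antisym (≤-trans (tww≤stww G tww stww) s≤t′) (tww-underlying≤tww G tww tww′)
  where
  s≤t′ : s ≤ t′
  s≤t′ = ≤⊔-<⇒≤ (stww≤tww-underlying⊔Δ² G stww tww′) Δ²<s
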